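{- Let $\{G_1'^{g_1'},G_2'^{g_2'},\ldots,G_n'^{g_n'}\}^g$ and $H_1'^{h_1'}$ be games with activeness. If $G_1'^{g_1'}=H_1'^{h_1'}$, then $\{G_1'^{g_1'},G_2'^{g_2'},\ldots,G_n'^{g_n'}\}^g=\{H_1'^{h_1'},G_2'^{g_2'},\ldots,G_n'^{g_n'}\}^g$.
   Context: Let $\mathcal{B}=\{0,1\}$. Define $\mathbb{I}_0=\{\emptyset\}\times\mathcal{B}$ and $\mathbb{I}_n=2^{\mathbb{I}_{n-1}}\times\mathcal{B}$ for $n\ge1$; a game with activeness is an element of $\mathbb{I}=\bigcup_{n\ge0}\mathbb{I}_n$. A pair $(G,g)$ is written $G^g$; elements of $G$ are its options, $g=1$ meaning active. The outcome $o$ is defined recursively: $o(G^g)=\mathscr{N}$ if $g=1$ and some option has outcome $\mathscr{P}$, and $o(G^g)=\mathscr{P}$ otherwise. The sum is $G^g+H^h=(\{G'^{g'}+H^h:G'^{g'}\in G^g\}\cup\{G^g+H'^{h'}:H'^{h'}\in H^h\})^{\max\{g,h\}}$. $G^g=H^h$ means $o(G^g+X^x)=o(H^h+X^x)$ for all games $X^x$. -}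

module Defs where

open import Data.Bool using (Bool; true; false; _∨_)
open import Data.List using (List; []; _∷_; _++_)
open import Relation.Binary.PropositionalEquality using (_≡_)

-- A game with activeness G^g: a finite collection of options (games with
-- activeness) together with an activeness bit g (true = active = 1).
data Game : Set where
  _^_ : List Game → Bool → Game

data Outcome : Set where
  𝒩 𝒫 : Outcome

mutual
  o : Game → Outcome
  o (Gs ^ false) = 𝒫
  o (Gs ^ true)  = someP Gs

  someP : List Game → Outcome
  someP []       = 𝒫
  someP (G ∷ Gs) with o G
  ... | 𝒫 = 𝒩
  ... | 𝒩 = someP Gs

mutual
  infixl 6 _+_
  _+_ : Game → Game → Game
  (Gs ^ g) + (Hs ^ h) = (leftSum Gs (Hs ^ h) ++ rightSum (Gs ^ g) Hs) ^ (g ∨ h)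

  leftSum : List Game → Game → List Game
  leftSum []       H = []
  leftSum (G ∷ Gs) H = (G + H) ∷ leftSum Gs H

  rightSum : Game → List Game → List Game
  rightSum G []       = []
  rightSum G (H ∷ Hs) = (G + H) ∷ rightSum G Hs

infix 4 _≈_
_≈_ : Game → Game → Set
G ≈ H = ∀ X → o (G + X) ≡ o (H + X)

-- The outcome of a game depends only on its activeness and the outcomes of its
-- options. The options of (Gs ^ g) + X are the sums G + X with G in Gs together
-- with the sums (Gs ^ g) + X' with X' an option of X; the former keep their
-- outcomes when each G is replaced by an equal game, and the latter by induction
-- on X.
module Submission where

open import Defs
open import Data.Bool using (Bool; true; false; _∨_)
open import Data.List using (List; []; _∷_)
open import Data.List.Relation.Binary.Pointwise as Pointwise using (Pointwise; []; _∷_)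
open import Relation.Binary.PropositionalEquality using (_≡_; refl)

infix 4 _≡ₒ_
_≡ₒ_ : Game → Game → Set
G ≡ₒ H = o G ≡ o H

≈-refl : ∀ {G} → G ≈ G
≈-refl _ = refl

someP-cong : ∀ {Gs Hs} → Pointwise _≡ₒ_ Gs Hs → someP Gs ≡ someP Hs
someP-cong [] = refl
someP-cong {G ∷ _} {H ∷ _} (G≡ₒH ∷ Gs≡ₒHs) with o G | o H | G≡ₒH
... | 𝒫 | 𝒫 | refl = refl
... | 𝒩 | 𝒩 | refl = someP-cong Gs≡ₒHs

o-cong : ∀ g {Gs Hs} → Pointwise _≡ₒ_ Gs Hs → o (Gs ^ g) ≡ o (Hs ^ g)
o-cong false _ = refl
o-cong true Gs≡ₒHs = someP-cong Gs≡ₒHs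

leftSum-cong : ∀ {Gs Hs} → Pointwise _≈_ Gs Hs → ∀ X →
               Pointwise _≡ₒ_ (leftSum Gs X) (leftSum Hs X)
leftSum-cong [] X = []
leftSum-cong (G≈H ∷ Gs≈Hs) X = G≈H X ∷ leftSum-cong Gs≈Hs X

mutual
  ^-cong : ∀ {Gs Hs} → Pointwise _≈_ Gs Hs → ∀ g → (Gs ^ g) ≈ (Hs ^ g)
  ^-cong Gs≈Hs g (Xs ^ x) =
    o-cong (g ∨ x) (Pointwise.++⁺ (leftSum-cong Gs≈Hs (Xs ^ x)) (rightSum-cong Gs≈Hs g Xs))

  rightSum-cong : ∀ {Gs Hs} → Pointwise _≈_ Gs Hs → ∀ g Xs →
                  Pointwise _≡ₒ_ (rightSum (Gs ^ g) Xs) (rightSum (Hs ^ g) Xs)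
  rightSum-cong Gs≈Hs g [] = []
  rightSum-cong Gs≈Hs g (X ∷ Xs) = ^-cong Gs≈Hs g X ∷ rightSum-cong Gs≈Hs g Xs

theorem3p26 : (G₁ H₁ : Game) (Gs : List Game) (g : Bool) →
    G₁ ≈ H₁ → ((G₁ ∷ Gs) ^ g) ≈ ((H₁ ∷ Gs) ^ g)
theorem3p26 G₁ H₁ Gs g G₁≈H₁ = ^-cong (G₁≈H₁ ∷ Pointwise.refl (λ {G} → ≈-refl {G})) g
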